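{- Let $p$ be a prime, $n,m\in\mathbb{N}$. For $0\le i\le n$ and $0\le k\le m$, $\mathrm{ann}_{R_mG_i}p^k=\langle p^{m-k}\rangle$. For $0\le j<i\le n$ and $0\le k\le m$, $$\mathrm{ann}_{R_mG_i}\,p^k(\sigma^{p^j}-1)=\langle P(i,j),p^{m-k}\rangle.$$
   Context: $G$ is cyclic of order $p^n$ with generator $\sigma$; $G_i$ is its quotient of order $p^i$ (image of $\sigma$ still written $\sigma$). $R_m=\mathbb{Z}/p^m\mathbb{Z}$, $R_mG_i$ the group ring. $P(i,j)=\sum_{k=0}^{p^{i-j}-1}\sigma^{kp^j}$. $\langle\cdot\rangle$ denotes the ideal of $R_mG_i$ generated. -}

module Defs where

open import Data.Nat as ℕ using (ℕ; zero; suc)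
open import Data.Nat.DivMod using (_mod_)
open import Data.Fin as Fin using (Fin; toℕ)
open import Data.Fin.Properties using () renaming (_≟_ to _≟F_)
open import Data.Integer as ℤ using (ℤ; +_; 0ℤ; 1ℤ)
open import Data.Integer.Divisibility using (_∣_)
open import Data.List using (List; map; foldr; upTo; allFin)
open import Data.Product using (∃; ∃₂)
open import Relation.Nullary using (yes; no)

sumℤ : List ℤ → ℤ
sumℤ = foldr ℤ._+_ 0ℤ

-- Reduce a natural number modulo N into Fin N (N is nonzero as Fin N is inhabited).
red : ∀ {N} → Fin N → ℕ → Fin N
red {suc n} _ x = x mod suc n

-- Group ring (ℤ/M)[C_N] : an element is a coefficient function on
-- C_N = {σ^0,…,σ^(N-1)}, coefficient of σ^t at index t; coefficients are
-- integers read modulo M (equality is _≈_ below).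
GR : ℕ → Set
GR N = Fin N → ℤ

module GroupRing (M N : ℕ) where

  _≈_ : GR N → GR N → Set
  f ≈ g = ∀ t → (+ M) ∣ (f t ℤ.- g t)

  _+ᴳ_ : GR N → GR N → GR N
  (f +ᴳ g) t = f t ℤ.+ g t

  _-ᴳ_ : GR N → GR N → GR N
  (f -ᴳ g) t = f t ℤ.- g t

  0ᴳ : GR N
  0ᴳ _ = 0ℤ

  -- group ring multiplication (convolution over the cyclic group C_N):
  -- (f ⋆ g)(σ^t) = Σ_a f(σ^a) g(σ^(t-a))
  _⋆_ : GR N → GR N → GR N
  (f ⋆ g) t = sumℤ (map (λ a → f a ℤ.* g (red t (toℕ t ℕ.+ (N ℕ.∸ toℕ a)))) (allFin N))

  σ^ : ℕ → GR N
  σ^ e t with red t e ≟F t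
  ... | yes _ = 1ℤ
  ... | no _ = 0ℤ

  ι : ℤ → GR N
  ι c t = c ℤ.* σ^ 0 t

  Σᴳ : List (GR N) → GR N
  Σᴳ = foldr _+ᴳ_ 0ᴳ

  InAnn : GR N → GR N → Set
  InAnn a x = (x ⋆ a) ≈ 0ᴳ

  InIdeal₁ : GR N → GR N → Set
  InIdeal₁ g x = ∃ λ r → x ≈ (r ⋆ g)

  InIdeal₂ : GR N → GR N → GR N → Set
  InIdeal₂ g h x = ∃₂ λ r s → x ≈ ((r ⋆ g) +ᴳ (s ⋆ h))

-- R_m G_i = (ℤ/p^m)[C_{p^i}]
module RG (p m i : ℕ) = GroupRing (p ℕ.^ m) (p ℕ.^ i)

P : (p m i j : ℕ) → GR (p ℕ.^ i)
P p m i j = Σᴳ (map (λ k → σ^ (k ℕ.* p ℕ.^ j)) (upTo (p ℕ.^ (i ℕ.∸ j))))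
  where open RG p m i

-- Write p^m = d·c with d = p^(m-k), c = p^k, and let q = p^j.  The coefficient of σ^t in
-- x·c(σ^q - 1) is c·(x(t-q) - x(t)), so x lies in the annihilator exactly when its coefficients
-- are q-periodic modulo d (for the annihilator of c: exactly when d divides all of them).
-- Every r·P is exactly q-periodic; conversely, if r is the truncation of x to 0 ≤ t < q then
-- (r·P)(t) = x(t mod q), which a q-periodic-mod-d x matches up to a multiple of d.
module Submission where

open import Data.Empty using (⊥-elim)
open import Data.Fin as Fin using (Fin; toℕ; fromℕ<)
import Data.Fin.Properties as FinP
open import Data.Integer as ℤ using (ℤ; +_; 0ℤ; 1ℤ; -1ℤ; _+_; _-_; _*_; -_)
import Data.Integer.Divisibility.Signed as ℤD
import Data.Integer.Properties as ℤP
open import Data.Integer.Tactic.RingSolver using (solve-∀)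
open import Data.List using ([]; _∷_; map; tabulate; applyUpTo; upTo; allFin)
import Data.List.Properties as LP
open import Data.Nat as ℕ using (ℕ; zero; suc; NonZero; _≤_; _<_; _^_; _∸_)
import Data.Nat.Divisibility as ℕD
open import Data.Nat.DivMod using (_%_; _/_; m≡m%n+[m/n]*n; m%n<n; m<n⇒m%n≡m; m≤n⇒[n∸m]%m≡n%m)
open import Data.Nat.Primality using (Prime; prime⇒nonZero)
import Data.Nat.Properties as ℕP
open import Data.Product using (_×_; _,_)
open import Data.Sum using (inj₁; inj₂)
open import Data.Vec.Functional as Vec using (Vector)
open import Function using (_∘_; id)
open import Function.Bundles using (_⇔_; mk⇔; Equivalence)
import Function.Properties.Equivalence as ⇔
open import Level using (0ℓ)
open import Relation.Binary.Bundles using (Setoid)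
open import Relation.Binary.PropositionalEquality
import Relation.Binary.Reasoning.Setoid as SetoidReasoning
open import Relation.Nullary using (¬_; Dec; yes; no)
import Relation.Nullary.Decidable as Dec
open import Algebra.Properties.Semiring.Sum ℤP.+-*-semiring
  using (sum; sum-cong-≗; ∑-distrib-+; sum-remove; sum-replicate-zero)

open import Defs

infix 4 _≡_mod_
record _≡_mod_ (a b : ℤ) (K : ℕ) : Set where
  constructor divides-difference
  field ∣-difference : + K ℤD.∣ a - b
open _≡_mod_

module _ {K : ℕ} where

  ≡-mod-reflexive : ∀ {a b} → a ≡ b → a ≡ b mod K
  ≡-mod-reflexive {a} refl = divides-difference (ℤD.divides 0ℤ (ℤP.+-inverseʳ a))

  ≡-mod-refl : ∀ {a} → a ≡ a mod K
  ≡-mod-refl = ≡-mod-reflexive refl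

  ≡-mod-sym : ∀ {a b} → a ≡ b mod K → b ≡ a mod K
  ≡-mod-sym {a} {b} (divides-difference d) =
    divides-difference (subst (+ K ℤD.∣_) (neg-difference a b) (ℤD.∣m⇒∣-m d))
    where
    neg-difference : ∀ a b → - (a - b) ≡ b - a
    neg-difference = solve-∀

  ≡-mod-trans : ∀ {a b c} → a ≡ b mod K → b ≡ c mod K → a ≡ c mod K
  ≡-mod-trans {a} {b} {c} (divides-difference d) (divides-difference e) =
    divides-difference (subst (+ K ℤD.∣_) (telescope a b c) (ℤD.∣m∣n⇒∣m+n d e))
    where
    telescope : ∀ a b c → (a - b) + (b - c) ≡ a - c
    telescope = solve-∀

  ≡-mod-- : ∀ {a b c d} → a ≡ b mod K → c ≡ d mod K → a - c ≡ b - d mod K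
  ≡-mod-- {a} {b} {c} {d} (divides-difference e) (divides-difference f) =
    divides-difference (subst (+ K ℤD.∣_) (rearrange a b c d) (ℤD.∣m∣n⇒∣m-n e f))
    where
    rearrange : ∀ a b c d → (a - b) - (c - d) ≡ (a - c) - (b - d)
    rearrange = solve-∀

  +-multiple-≡-mod : ∀ a k → a + k * + K ≡ a mod K
  +-multiple-≡-mod a k = divides-difference (ℤD.divides k (cancel a (k * + K)))
    where
    cancel : ∀ a b → a + b - a ≡ b
    cancel = solve-∀

  ≡-mod-swap : ∀ t {a b} → a ≡ t - b mod K → b ≡ t - a mod K
  ≡-mod-swap t {a} {b} (divides-difference d) =
    divides-difference (subst (+ K ℤD.∣_) (rearrange a b t) d)
    where
    rearrange : ∀ a b t → a - (t - b) ≡ b - (t - a)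
    rearrange = solve-∀

  multiple-≡-mod-0 : ∀ k → k * + K ≡ 0ℤ mod K
  multiple-≡-mod-0 k =
    ≡-mod-trans (≡-mod-reflexive (sym (ℤP.+-identityˡ (k * + K)))) (+-multiple-≡-mod 0ℤ k)

  ≡-mod⇔-≡-mod-0 : ∀ {a b} → a ≡ b mod K ⇔ a - b ≡ 0ℤ mod K
  ≡-mod⇔-≡-mod-0 {a} {b} = mk⇔
    (λ (divides-difference d) → divides-difference (subst (+ K ℤD.∣_) (sym a-b-0≡a-b) d))
    (λ (divides-difference d) → divides-difference (subst (+ K ℤD.∣_) a-b-0≡a-b d))
    where
    a-b-0≡a-b : (a - b) - 0ℤ ≡ a - b
    a-b-0≡a-b = ℤP.+-identityʳ (a - b)

≡-mod-setoid : ℕ → Setoid 0ℓ 0ℓ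
≡-mod-setoid K = record
  { Carrier = ℤ
  ; _≈_ = _≡_mod K
  ; isEquivalence = record { refl = ≡-mod-refl ; sym = ≡-mod-sym ; trans = ≡-mod-trans }
  }

module ≡-mod-Reasoning (K : ℕ) = SetoidReasoning (≡-mod-setoid K)

≡-mod-∣ : ∀ {K L a b} → L ℕD.∣ K → a ≡ b mod K → a ≡ b mod L
≡-mod-∣ {K} {L} (ℕD.divides k K≡kL) (divides-difference d) =
  divides-difference (ℤD.∣-trans (ℤD.divides (+ k) (trans (cong +_ K≡kL) (ℤP.pos-* k L))) d)

private
  *-distribʳ-- : ∀ c a b → (a - b) * c ≡ a * c - b * c
  *-distribʳ-- = solve-∀

*-cancelʳ-≡-mod : ∀ d c .{{_ : NonZero c}} a b → a * + c ≡ b * + c mod d ℕ.* c → a ≡ b mod d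
*-cancelʳ-≡-mod d c a b (divides-difference dc∣) = divides-difference
  (ℤD.*-cancelʳ-∣ (+ c) (subst₂ ℤD._∣_ (ℤP.pos-* d c) (sym (*-distribʳ-- (+ c) a b)) dc∣))

*-monoʳ-≡-mod : ∀ d c a b → a ≡ b mod d → a * + c ≡ b * + c mod d ℕ.* c
*-monoʳ-≡-mod d c a b (divides-difference d∣) = divides-difference
  (subst₂ ℤD._∣_ (sym (ℤP.pos-* d c)) (*-distribʳ-- (+ c) a b) (ℤD.*-monoˡ-∣ (+ c) d∣))

infix 4 _≡?_mod_
_≡?_mod_ : ∀ a b K → Dec (a ≡ b mod K)
a ≡? b mod K = Dec.map′ divides-difference ∣-difference (+ K ℤD.∣? a - b)

≡-mod-0⇒∣ : ∀ {K n} → + n ≡ 0ℤ mod K → K ℕD.∣ n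
≡-mod-0⇒∣ {K} {n} (divides-difference K∣n-0) =
  ℤD.∣⇒∣ᵤ (subst (+ K ℤD.∣_) (ℤP.+-identityʳ (+ n)) K∣n-0)

pos-∸ : ∀ {m n} → n ≤ m → + (m ∸ n) ≡ + m - + n
pos-∸ {m} {n} n≤m = sym (trans (ℤP.m-n≡m⊖n m n) (ℤP.⊖-≥ n≤m))

private
  ≡-mod⇒≡-≤ : ∀ {K a b} → b ≤ a → a < K → + a ≡ + b mod K → a ≡ b
  ≡-mod⇒≡-≤ {K} {a} {b} b≤a a<K (divides-difference d) =
    ℕP.≤-antisym (ℕP.m∸n≡0⇒m≤n a∸b≡0) b≤a
    where
    instance
      K≢0 : NonZero K
      K≢0 = ℕ.>-nonZero (ℕP.<-≤-trans (ℕ.s≤s ℕ.z≤n) a<K)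
    K∣a∸b : K ℕD.∣ a ∸ b
    K∣a∸b = ℤD.∣⇒∣ᵤ (subst (+ K ℤD.∣_) (sym (pos-∸ b≤a)) d)
    a∸b≡0 : a ∸ b ≡ 0
    a∸b≡0 = begin
      a ∸ b       ≡⟨ m<n⇒m%n≡m (ℕP.≤-<-trans (ℕP.m∸n≤m a b) a<K) ⟨
      (a ∸ b) % K ≡⟨ ℕD.n∣m⇒m%n≡0 (a ∸ b) K K∣a∸b ⟩
      0           ∎
      where open ≡-Reasoning

≡-mod⇒≡ : ∀ {K a b} → a < K → b < K → + a ≡ + b mod K → a ≡ b
≡-mod⇒≡ {K} {a} {b} a<K b<K a≡b with ℕP.≤-total b a
... | inj₁ b≤a = ≡-mod⇒≡-≤ b≤a a<K a≡b
... | inj₂ a≤b = sym (≡-mod⇒≡-≤ a≤b b<K (≡-mod-sym a≡b))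

%-≡-mod : ∀ K .{{_ : NonZero K}} n → + (n % K) ≡ + n mod K
%-≡-mod K n = ≡-mod-sym (begin
  + n                           ≡⟨ cong +_ (m≡m%n+[m/n]*n n K) ⟩
  + (n % K ℕ.+ n / K ℕ.* K)     ≡⟨ ℤP.pos-+ (n % K) _ ⟩
  + (n % K) + + (n / K ℕ.* K)   ≡⟨ cong (_+_ (+ (n % K))) (ℤP.pos-* (n / K) K) ⟩
  + (n % K) + + (n / K) * + K   ≈⟨ +-multiple-≡-mod _ (+ (n / K)) ⟩
  + (n % K)                     ∎)
  where open ≡-mod-Reasoning K

sumℤ-tabulate : ∀ {n} (f : Vector ℤ n) → sumℤ (tabulate f) ≡ sum f
sumℤ-tabulate {zero} f = refl
sumℤ-tabulate {suc n} f = cong (_+_ (f Fin.zero)) (sumℤ-tabulate (f ∘ Fin.suc))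

sumℤ-allFin : ∀ {n} (f : Vector ℤ n) → sumℤ (map f (allFin n)) ≡ sum f
sumℤ-allFin f = trans (cong sumℤ (LP.map-tabulate id f)) (sumℤ-tabulate f)

sumℤ-applyUpTo : ∀ n (g : ℕ → ℤ) → sumℤ (applyUpTo g n) ≡ sum {n} (g ∘ toℕ)
sumℤ-applyUpTo zero g = refl
sumℤ-applyUpTo (suc n) g = cong (_+_ (g 0)) (sumℤ-applyUpTo n (g ∘ suc))

sum-zero : ∀ {n} (f : Vector ℤ n) → (∀ i → f i ≡ 0ℤ) → sum f ≡ 0ℤ
sum-zero {n} f f≗0 = trans (sum-cong-≗ f≗0) (sum-replicate-zero n)

sum-vanishing-off : ∀ {n} (f : Vector ℤ n) i → (∀ j → j ≢ i → f j ≡ 0ℤ) → sum f ≡ f i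
sum-vanishing-off {suc n} f i f≗0 = begin
  sum f                          ≡⟨ sum-remove {i = i} f ⟩
  f i + sum (Vec.removeAt f i)   ≡⟨ cong (_+_ (f i)) (sum-zero _ (λ j → f≗0 _ (FinP.punchInᵢ≢i i j))) ⟩
  f i + 0ℤ                       ≡⟨ ℤP.+-identityʳ (f i) ⟩
  f i                            ∎
  where open ≡-Reasoning

red-≡-mod : ∀ {N} (t : Fin N) x → + toℕ (red t x) ≡ + x mod N
red-≡-mod {suc n} t x =
  subst (λ k → + k ≡ + x mod suc n) (sym (FinP.toℕ-fromℕ< (m%n<n x (suc n)))) (%-≡-mod (suc n) x)

toℕ-red-0 : ∀ {N} (t : Fin N) → toℕ (red t 0) ≡ 0
toℕ-red-0 {suc n} t = refl

toℕ-≡-mod-injective : ∀ {K} {s t : Fin K} → + toℕ s ≡ + toℕ t mod K → s ≡ t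
toℕ-≡-mod-injective {s = s} {t} s≡t =
  FinP.toℕ-injective (≡-mod⇒≡ (FinP.toℕ<n s) (FinP.toℕ<n t) s≡t)

module _ {N : ℕ} where

  infixl 6 _⊖_

  -- The convolution in Defs reads (f ⋆ g) t = Σ_a f a * g (t ⊖ toℕ a).
  _⊖_ : Fin N → ℕ → Fin N
  t ⊖ e = red t (toℕ t ℕ.+ (N ∸ e))

  ⊖-≡-mod : ∀ t e → e ≤ N → + toℕ (t ⊖ e) ≡ + toℕ t - + e mod N
  ⊖-≡-mod t e e≤N = begin
    + toℕ (t ⊖ e)                 ≈⟨ red-≡-mod t _ ⟩
    + (toℕ t ℕ.+ (N ∸ e))         ≡⟨ unfold ⟩
    (+ toℕ t - + e) + 1ℤ * + N    ≈⟨ +-multiple-≡-mod _ 1ℤ ⟩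
    + toℕ t - + e                 ∎
    where
    open ≡-mod-Reasoning N
    rearrange : ∀ t n e → t + (n - e) ≡ (t - e) + 1ℤ * n
    rearrange = solve-∀
    unfold : + (toℕ t ℕ.+ (N ∸ e)) ≡ (+ toℕ t - + e) + 1ℤ * + N
    unfold = trans (ℤP.pos-+ (toℕ t) (N ∸ e))
      (trans (cong (_+_ (+ toℕ t)) (pos-∸ e≤N))
             (rearrange (+ toℕ t) (+ N) (+ e)))

  ⊖-toℕ-≡-mod : ∀ t (a : Fin N) → + toℕ (t ⊖ toℕ a) ≡ + toℕ t - + toℕ a mod N
  ⊖-toℕ-≡-mod t a = ⊖-≡-mod t (toℕ a) (ℕP.<⇒≤ (FinP.toℕ<n a))

  ⊖-zero : ∀ t → t ⊖ 0 ≡ t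
  ⊖-zero t = toℕ-≡-mod-injective
    (≡-mod-trans (⊖-≡-mod t 0 ℕ.z≤n) (≡-mod-reflexive (ℤP.+-identityʳ (+ toℕ t))))

  toℕ-⊖ : ∀ t e → e ≤ toℕ t → toℕ (t ⊖ e) ≡ toℕ t ∸ e
  toℕ-⊖ t e e≤t =
    ≡-mod⇒≡ (FinP.toℕ<n (t ⊖ e)) (ℕP.≤-<-trans (ℕP.m∸n≤m (toℕ t) e) (FinP.toℕ<n t))
      (≡-mod-trans (⊖-≡-mod t e e≤N) (≡-mod-reflexive (sym (pos-∸ e≤t))))
    where
    e≤N : e ≤ N
    e≤N = ℕP.<⇒≤ (ℕP.≤-<-trans e≤t (FinP.toℕ<n t))

module GroupRingProperties (M N : ℕ) where
  open GroupRing M N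

  σ^-≡-1 : ∀ {e} v → + e ≡ + toℕ v mod N → σ^ e v ≡ 1ℤ
  σ^-≡-1 {e} v e≡v with red v e FinP.≟ v
  ... | yes _ = refl
  ... | no red≢v = ⊥-elim (red≢v (toℕ-≡-mod-injective (≡-mod-trans (red-≡-mod v e) e≡v)))

  σ^-≢-0 : ∀ {e} v → ¬ (+ e ≡ + toℕ v mod N) → σ^ e v ≡ 0ℤ
  σ^-≢-0 {e} v e≢v with red v e FinP.≟ v
  ... | yes red≡v =
    ⊥-elim (e≢v (≡-mod-trans (≡-mod-sym (red-≡-mod v e)) (≡-mod-reflexive (cong (+_ ∘ toℕ) red≡v))))
  ... | no _ = refl

  ⋆-as-sum : ∀ f g t → (f ⋆ g) t ≡ sum (λ a → f a * g (t ⊖ toℕ a))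
  ⋆-as-sum f g t = sumℤ-allFin (λ a → f a * g (t ⊖ toℕ a))

  ⋆-σ^ : ∀ f e → e ≤ N → ∀ t → (f ⋆ σ^ e) t ≡ f (t ⊖ e)
  ⋆-σ^ f e e≤N t = begin
    (f ⋆ σ^ e) t                          ≡⟨ ⋆-as-sum f (σ^ e) t ⟩
    sum (λ a → f a * σ^ e (t ⊖ toℕ a))    ≡⟨ sum-vanishing-off _ (t ⊖ e) off-diagonal ⟩
    f (t ⊖ e) * σ^ e (t ⊖ toℕ (t ⊖ e))    ≡⟨ cong (f (t ⊖ e) *_) (σ^-≡-1 _ diagonal) ⟩
    f (t ⊖ e) * 1ℤ                        ≡⟨ ℤP.*-identityʳ _ ⟩
    f (t ⊖ e)                             ∎
    where
    open ≡-Reasoning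
    diagonal : + e ≡ + toℕ (t ⊖ toℕ (t ⊖ e)) mod N
    diagonal =
      ≡-mod-trans (≡-mod-swap (+ toℕ t) (⊖-≡-mod t e e≤N)) (≡-mod-sym (⊖-toℕ-≡-mod t (t ⊖ e)))
    off-diagonal : ∀ a → a ≢ t ⊖ e → f a * σ^ e (t ⊖ toℕ a) ≡ 0ℤ
    off-diagonal a a≢t⊖e = trans (cong (f a *_) (σ^-≢-0 _ e≢t⊖a)) (ℤP.*-zeroʳ (f a))
      where
      e≢t⊖a : ¬ (+ e ≡ + toℕ (t ⊖ toℕ a) mod N)
      e≢t⊖a e≡t⊖a = a≢t⊖e (toℕ-≡-mod-injective
        (≡-mod-trans (≡-mod-swap (+ toℕ t) (≡-mod-trans e≡t⊖a (⊖-toℕ-≡-mod t a)))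
                     (≡-mod-sym (⊖-≡-mod t e e≤N))))

  ⋆-ι : ∀ f c t → (f ⋆ ι c) t ≡ f t * c
  ⋆-ι f c t = begin
    (f ⋆ ι c) t                                 ≡⟨ ⋆-as-sum f (ι c) t ⟩
    sum (λ a → f a * (c * σ^ 0 (t ⊖ toℕ a)))    ≡⟨ sum-cong-≗ (λ a → sym (ℤP.*-assoc (f a) c _)) ⟩
    sum (λ a → f a * c * σ^ 0 (t ⊖ toℕ a))      ≡⟨ ⋆-as-sum (λ a → f a * c) (σ^ 0) t ⟨
    ((λ a → f a * c) ⋆ σ^ 0) t                  ≡⟨ ⋆-σ^ (λ a → f a * c) 0 ℕ.z≤n t ⟩
    f (t ⊖ 0) * c                               ≡⟨ cong (λ v → f v * c) (⊖-zero t) ⟩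
    f t * c                                     ∎
    where open ≡-Reasoning

  ι-⋆ : ∀ c g t → (ι c ⋆ g) t ≡ c * g t
  ι-⋆ c g t = begin
    (ι c ⋆ g) t                                 ≡⟨ ⋆-as-sum (ι c) g t ⟩
    sum (λ a → c * σ^ 0 a * g (t ⊖ toℕ a))      ≡⟨ sum-vanishing-off _ o off-o ⟩
    c * σ^ 0 o * g (t ⊖ toℕ o)                  ≡⟨ cong₂ (λ s v → c * s * g v) σ^0-o t⊖o≡t ⟩
    c * 1ℤ * g t                                ≡⟨ cong (_* g t) (ℤP.*-identityʳ c) ⟩
    c * g t                                     ∎
    where
    open ≡-Reasoning
    o : Fin N
    o = red t 0
    σ^0-o : σ^ 0 o ≡ 1ℤ
    σ^0-o = σ^-≡-1 o (≡-mod-reflexive (cong +_ (sym (toℕ-red-0 t))))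
    t⊖o≡t : t ⊖ toℕ o ≡ t
    t⊖o≡t = trans (cong (t ⊖_) (toℕ-red-0 t)) (⊖-zero t)
    off-o : ∀ a → a ≢ o → c * σ^ 0 a * g (t ⊖ toℕ a) ≡ 0ℤ
    off-o a a≢o = begin
      c * σ^ 0 a * g (t ⊖ toℕ a)    ≡⟨ cong (λ s → c * s * g (t ⊖ toℕ a)) (σ^-≢-0 a 0≢a) ⟩
      c * 0ℤ * g (t ⊖ toℕ a)        ≡⟨ cong (_* g (t ⊖ toℕ a)) (ℤP.*-zeroʳ c) ⟩
      0ℤ * g (t ⊖ toℕ a)            ≡⟨ ℤP.*-zeroˡ (g (t ⊖ toℕ a)) ⟩
      0ℤ                            ∎
      where
      0≢a : ¬ (+ 0 ≡ + toℕ a mod N)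
      0≢a 0≡a = a≢o (toℕ-≡-mod-injective
        (subst (λ k → + toℕ a ≡ + k mod N) (sym (toℕ-red-0 t)) (≡-mod-sym 0≡a)))

  ⋆-ι⋆[σ^-1] : ∀ x c e → e ≤ N → ∀ t → (x ⋆ (ι c ⋆ (σ^ e -ᴳ σ^ 0))) t ≡ (x (t ⊖ e) - x t) * c
  ⋆-ι⋆[σ^-1] x c e e≤N t = begin
    (x ⋆ (ι c ⋆ (σ^ e -ᴳ σ^ 0))) t
      ≡⟨ ⋆-as-sum x (ι c ⋆ (σ^ e -ᴳ σ^ 0)) t ⟩
    sum (λ a → x a * (ι c ⋆ (σ^ e -ᴳ σ^ 0)) (t ⊖ toℕ a))
      ≡⟨ sum-cong-≗ (λ a → trans (cong (x a *_) (ι-⋆ c (σ^ e -ᴳ σ^ 0) (t ⊖ toℕ a))) (expand (x a) c _ _)) ⟩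
    sum (λ a → x·c a * σ^ e (t ⊖ toℕ a) + -x·c a * σ^ 0 (t ⊖ toℕ a))
      ≡⟨ ∑-distrib-+ (λ a → x·c a * σ^ e (t ⊖ toℕ a)) (λ a → -x·c a * σ^ 0 (t ⊖ toℕ a)) ⟩
    sum (λ a → x·c a * σ^ e (t ⊖ toℕ a)) + sum (λ a → -x·c a * σ^ 0 (t ⊖ toℕ a))
      ≡⟨ cong₂ _+_ (⋆-as-sum x·c (σ^ e) t) (⋆-as-sum -x·c (σ^ 0) t) ⟨
    (x·c ⋆ σ^ e) t + (-x·c ⋆ σ^ 0) t
      ≡⟨ cong₂ _+_ (⋆-σ^ x·c e e≤N t) (trans (⋆-σ^ -x·c 0 ℕ.z≤n t) (cong -x·c (⊖-zero t))) ⟩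
    x (t ⊖ e) * c + - x t * c
      ≡⟨ ℤP.*-distribʳ-+ c (x (t ⊖ e)) (- x t) ⟨
    (x (t ⊖ e) - x t) * c ∎
    where
    open ≡-Reasoning
    x·c -x·c : GR N
    x·c a = x a * c
    -x·c a = - x a * c
    expand : ∀ y c s z → y * (c * (s - z)) ≡ y * c * s + - y * c * z
    expand = solve-∀

  ≈⇔≡-mod : ∀ f g → f ≈ g ⇔ (∀ t → f t ≡ g t mod M)
  ≈⇔≡-mod f g = mk⇔
    (λ f≈g t → divides-difference (ℤD.∣ᵤ⇒∣ (f≈g t)))
    (λ f≡g t → ℤD.∣⇒∣ᵤ (∣-difference (f≡g t)))

  InAnn⇔≡-mod-0 : ∀ {d c} .{{_ : NonZero c}} → M ≡ d ℕ.* c → ∀ a x (y : GR N) →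
    (∀ t → (x ⋆ a) t ≡ y t * + c) → InAnn a x ⇔ (∀ t → y t ≡ 0ℤ mod d)
  InAnn⇔≡-mod-0 {d} {c} refl a x y x⋆a≡yc = mk⇔
    (λ ann t → *-cancelʳ-≡-mod d c (y t) 0ℤ (to-coefficient t (Equivalence.to coefficients ann t)))
    (λ y≡0 → Equivalence.from coefficients λ t →
      from-coefficient t (*-monoʳ-≡-mod d c (y t) 0ℤ (y≡0 t)))
    where
    coefficients : InAnn a x ⇔ (∀ t → (x ⋆ a) t ≡ 0ℤ mod d ℕ.* c)
    coefficients = ≈⇔≡-mod (x ⋆ a) 0ᴳ
    to-coefficient : ∀ t → (x ⋆ a) t ≡ 0ℤ mod d ℕ.* c → y t * + c ≡ 0ℤ * + c mod d ℕ.* c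
    to-coefficient t = subst₂ (_≡_mod d ℕ.* c) (x⋆a≡yc t) (sym (ℤP.*-zeroˡ (+ c)))
    from-coefficient : ∀ t → y t * + c ≡ 0ℤ * + c mod d ℕ.* c → (x ⋆ a) t ≡ 0ℤ mod d ℕ.* c
    from-coefficient t = subst₂ (_≡_mod d ℕ.* c) (sym (x⋆a≡yc t)) (ℤP.*-zeroˡ (+ c))

  InIdeal₁-ι⇔≡-mod-0 : ∀ {d} → d ℕD.∣ M → ∀ x →
    InIdeal₁ (ι (+ d)) x ⇔ (∀ t → x t ≡ 0ℤ mod d)
  InIdeal₁-ι⇔≡-mod-0 {d} d∣M x = mk⇔ to from
    where
    to : InIdeal₁ (ι (+ d)) x → ∀ t → x t ≡ 0ℤ mod d
    to (s , x≈sd) t = begin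
      x t              ≈⟨ ≡-mod-∣ d∣M (Equivalence.to (≈⇔≡-mod x (s ⋆ ι (+ d))) x≈sd t) ⟩
      (s ⋆ ι (+ d)) t  ≡⟨ ⋆-ι s (+ d) t ⟩
      s t * + d        ≈⟨ multiple-≡-mod-0 (s t) ⟩
      0ℤ               ∎
      where open ≡-mod-Reasoning d
    from : (∀ t → x t ≡ 0ℤ mod d) → InIdeal₁ (ι (+ d)) x
    from x≡0 = s , Equivalence.from (≈⇔≡-mod x (s ⋆ ι (+ d))) λ t →
      ≡-mod-reflexive (trans (ℤD._∣_.equality (d∣x t)) (sym (⋆-ι s (+ d) t)))
      where
      d∣x : ∀ t → + d ℤD.∣ x t
      d∣x t = subst (+ d ℤD.∣_) (ℤP.+-identityʳ (x t)) (∣-difference (x≡0 t))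
      s : GR N
      s t = ℤD.quotient (d∣x t)

  annihilator-ι : ∀ d c .{{_ : NonZero c}} → M ≡ d ℕ.* c → ∀ x →
    InAnn (ι (+ c)) x ⇔ InIdeal₁ (ι (+ d)) x
  annihilator-ι d c M≡dc x = ⇔.trans
    (InAnn⇔≡-mod-0 M≡dc (ι (+ c)) x x (⋆-ι x (+ c)))
    (⇔.sym (InIdeal₁-ι⇔≡-mod-0 (ℕD.divides c (trans M≡dc (ℕP.*-comm d c))) x))

  Σᴳ-apply : ∀ fs v → Σᴳ fs v ≡ sumℤ (map (λ f → f v) fs)
  Σᴳ-apply [] v = refl
  Σᴳ-apply (f ∷ fs) v = cong (_+_ (f v)) (Σᴳ-apply fs v)

  -- The norm element of the subgroup ⟨σ^q⟩ when N = D q; P p m i j is norm (p ^ j) (p ^ (i ∸ j)).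
  norm : ℕ → ℕ → GR N
  norm q D = Σᴳ (map (λ k → σ^ (k ℕ.* q)) (upTo D))

  norm-as-sum : ∀ q D v → norm q D v ≡ sum {D} (λ l → σ^ (toℕ l ℕ.* q) v)
  norm-as-sum q D v = begin
    norm q D v
      ≡⟨ Σᴳ-apply (map σ^q* (upTo D)) v ⟩
    sumℤ (map (λ f → f v) (map σ^q* (applyUpTo id D)))
      ≡⟨ cong (sumℤ ∘ map (λ f → f v)) (LP.map-applyUpTo id σ^q* D) ⟩
    sumℤ (map (λ f → f v) (applyUpTo σ^q* D))
      ≡⟨ cong sumℤ (LP.map-applyUpTo σ^q* (λ f → f v) D) ⟩
    sumℤ (applyUpTo (λ k → σ^ (k ℕ.* q) v) D)
      ≡⟨ sumℤ-applyUpTo D (λ k → σ^ (k ℕ.* q) v) ⟩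
    sum {D} (λ l → σ^ (toℕ l ℕ.* q) v) ∎
    where
    open ≡-Reasoning
    σ^q* : ℕ → GR N
    σ^q* k = σ^ (k ℕ.* q)

  module Norm (q D : ℕ) .{{_ : NonZero q}} .{{_ : NonZero D}} (N≡Dq : N ≡ D ℕ.* q) where

    Nq : GR N
    Nq = norm q D

    q∣N : q ℕD.∣ N
    q∣N = ℕD.divides D N≡Dq

    q≤N : q ≤ N
    q≤N = subst (q ≤_) (sym N≡Dq) (ℕP.m≤n*m q D)

    norm-≡-1 : ∀ v → + toℕ v ≡ 0ℤ mod q → Nq v ≡ 1ℤ
    norm-≡-1 v v≡0 = begin
      Nq v                                 ≡⟨ norm-as-sum q D v ⟩
      sum {D} (λ l → σ^ (toℕ l ℕ.* q) v)   ≡⟨ sum-vanishing-off _ k′ off-k ⟩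
      σ^ (toℕ k′ ℕ.* q) v                  ≡⟨ σ^-≡-1 v (≡-mod-reflexive (cong +_ k′q≡v)) ⟩
      1ℤ                                   ∎
      where
      open ≡-Reasoning
      k : ℕ
      k = ℕD.quotient (≡-mod-0⇒∣ v≡0)
      v≡kq : toℕ v ≡ k ℕ.* q
      v≡kq = ℕD._∣_.equality (≡-mod-0⇒∣ v≡0)
      k<D : k < D
      k<D = ℕP.*-cancelʳ-< q k D (subst₂ _<_ v≡kq N≡Dq (FinP.toℕ<n v))
      k′ : Fin D
      k′ = fromℕ< k<D
      k′q≡v : toℕ k′ ℕ.* q ≡ toℕ v
      k′q≡v = trans (cong (ℕ._* q) (FinP.toℕ-fromℕ< k<D)) (sym v≡kq)
      off-k : ∀ l → l ≢ k′ → σ^ (toℕ l ℕ.* q) v ≡ 0ℤ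
      off-k l l≢k′ with + (toℕ l ℕ.* q) ≡? + toℕ v mod N
      ... | no lq≢v = σ^-≢-0 v lq≢v
      ... | yes lq≡v = ⊥-elim (l≢k′ (FinP.toℕ-injective
          (trans (≡-mod⇒≡ (FinP.toℕ<n l) k<D l≡k) (sym (FinP.toℕ-fromℕ< k<D)))))
        where
        lq≡kq : + toℕ l * + q ≡ + k * + q mod D ℕ.* q
        lq≡kq = subst₂ (λ a K → a ≡ + k * + q mod K) (ℤP.pos-* (toℕ l) q) N≡Dq
          (≡-mod-trans lq≡v (≡-mod-reflexive (trans (cong +_ v≡kq) (ℤP.pos-* k q))))
        l≡k : + toℕ l ≡ + k mod D
        l≡k = *-cancelʳ-≡-mod D q (+ toℕ l) (+ k) lq≡kq

    norm-≡-0 : ∀ v → ¬ (+ toℕ v ≡ 0ℤ mod q) → Nq v ≡ 0ℤ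
    norm-≡-0 v v≢0 = trans (norm-as-sum q D v) (sum-zero {D} _ σ^lq≡0)
      where
      σ^lq≡0 : ∀ l → σ^ (toℕ l ℕ.* q) v ≡ 0ℤ
      σ^lq≡0 l with + (toℕ l ℕ.* q) ≡? + toℕ v mod N
      ... | no lq≢v = σ^-≢-0 v lq≢v
      ... | yes lq≡v = ⊥-elim (v≢0 (≡-mod-trans (≡-mod-sym (≡-mod-∣ q∣N lq≡v)) lq≡0))
        where
        lq≡0 : + (toℕ l ℕ.* q) ≡ 0ℤ mod q
        lq≡0 = subst (_≡ 0ℤ mod q) (sym (ℤP.pos-* (toℕ l) q)) (multiple-≡-mod-0 (+ toℕ l))

    norm-cong : ∀ v w → + toℕ v ≡ + toℕ w mod q → Nq v ≡ Nq w
    norm-cong v w v≡w with + toℕ w ≡? 0ℤ mod q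
    ... | yes w≡0 = trans (norm-≡-1 v (≡-mod-trans v≡w w≡0)) (sym (norm-≡-1 w w≡0))
    ... | no w≢0 = trans (norm-≡-0 v (w≢0 ∘ ≡-mod-trans (≡-mod-sym v≡w))) (sym (norm-≡-0 w w≢0))

    ⊖-q-≡-mod : ∀ t e → e ≤ N → + toℕ (t ⊖ q ⊖ e) ≡ + toℕ (t ⊖ e) mod q
    ⊖-q-≡-mod t e e≤N = begin
      + toℕ (t ⊖ q ⊖ e)             ≈⟨ ≡-mod-∣ q∣N (⊖-≡-mod (t ⊖ q) e e≤N) ⟩
      + toℕ (t ⊖ q) - + e           ≈⟨ ≡-mod-- (≡-mod-∣ q∣N (⊖-≡-mod t q q≤N)) (≡-mod-refl {a = + e}) ⟩
      + toℕ t - + q - + e           ≡⟨ rearrange (+ toℕ t) (+ q) (+ e) ⟩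
      (+ toℕ t - + e) + -1ℤ * + q   ≈⟨ +-multiple-≡-mod _ -1ℤ ⟩
      + toℕ t - + e                 ≈⟨ ≡-mod-∣ q∣N (⊖-≡-mod t e e≤N) ⟨
      + toℕ (t ⊖ e)                 ∎
      where
      open ≡-mod-Reasoning q
      rearrange : ∀ t q e → t - q - e ≡ (t - e) + -1ℤ * q
      rearrange = solve-∀

    ⋆-norm-periodic : ∀ r t → (r ⋆ Nq) (t ⊖ q) ≡ (r ⋆ Nq) t
    ⋆-norm-periodic r t = begin
      (r ⋆ Nq) (t ⊖ q)                       ≡⟨ ⋆-as-sum r Nq (t ⊖ q) ⟩
      sum (λ a → r a * Nq (t ⊖ q ⊖ toℕ a))   ≡⟨ sum-cong-≗ (λ a → cong (r a *_) (norm-cong _ _ (shift a))) ⟩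
      sum (λ a → r a * Nq (t ⊖ toℕ a))       ≡⟨ ⋆-as-sum r Nq t ⟨
      (r ⋆ Nq) t                             ∎
      where
      open ≡-Reasoning
      shift : ∀ a → + toℕ (t ⊖ q ⊖ toℕ a) ≡ + toℕ (t ⊖ toℕ a) mod q
      shift a = ⊖-q-≡-mod t (toℕ a) (ℕP.<⇒≤ (FinP.toℕ<n a))

    residue : Fin N → Fin N
    residue t = fromℕ< (ℕP.<-≤-trans (m%n<n (toℕ t) q) q≤N)

    toℕ-residue : ∀ t → toℕ (residue t) ≡ toℕ t % q
    toℕ-residue t = FinP.toℕ-fromℕ< _

    residue<q : ∀ t → toℕ (residue t) < q
    residue<q t = subst (_< q) (sym (toℕ-residue t)) (m%n<n (toℕ t) q)

    residue-≡-mod : ∀ t → + toℕ (residue t) ≡ + toℕ t mod q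
    residue-≡-mod t = subst (λ k → + k ≡ + toℕ t mod q) (sym (toℕ-residue t)) (%-≡-mod q (toℕ t))

    periodic⇒≡-residue : ∀ {d} x → (∀ t → x (t ⊖ q) ≡ x t mod d) →
      ∀ t → x t ≡ x (residue t) mod d
    periodic⇒≡-residue {d} x periodic t = below (suc (toℕ t)) t ℕP.≤-refl
      where
      below : ∀ n t → toℕ t < n → x t ≡ x (residue t) mod d
      below (suc n) t t<1+n with toℕ t ℕ.<? q
      ... | yes t<q =
        ≡-mod-reflexive (cong x (FinP.toℕ-injective (sym (trans (toℕ-residue t) (m<n⇒m%n≡m t<q)))))
      ... | no t≮q = ≡-mod-trans (≡-mod-sym (periodic t))
                       (subst (λ u → x (t ⊖ q) ≡ x u mod d) same-residue (below n (t ⊖ q) t⊖q<n))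
        where
        q≤t : q ≤ toℕ t
        q≤t = ℕP.≮⇒≥ t≮q
        t⊖q<n : toℕ (t ⊖ q) < n
        t⊖q<n = subst (_< n) (sym (toℕ-⊖ t q q≤t))
          (ℕP.<-≤-trans (ℕP.∸-monoʳ-< (ℕP.n≢0⇒n>0 (ℕ.≢-nonZero⁻¹ q)) q≤t) (ℕ.s≤s⁻¹ t<1+n))
        same-residue : residue (t ⊖ q) ≡ residue t
        same-residue = FinP.toℕ-injective (begin
          toℕ (residue (t ⊖ q))  ≡⟨ toℕ-residue (t ⊖ q) ⟩
          toℕ (t ⊖ q) % q        ≡⟨ cong (_% q) (toℕ-⊖ t q q≤t) ⟩
          (toℕ t ∸ q) % q        ≡⟨ m≤n⇒[n∸m]%m≡n%m q≤t ⟩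
          toℕ t % q              ≡⟨ toℕ-residue t ⟨
          toℕ (residue t)        ∎)
          where open ≡-Reasoning

    truncate : GR N → GR N
    truncate x a with toℕ a ℕ.<? q
    ... | yes _ = x a
    ... | no _ = 0ℤ

    truncate-< : ∀ x a → toℕ a < q → truncate x a ≡ x a
    truncate-< x a a<q with toℕ a ℕ.<? q
    ... | yes _ = refl
    ... | no a≮q = ⊥-elim (a≮q a<q)

    truncate-≥ : ∀ x a → q ≤ toℕ a → truncate x a ≡ 0ℤ
    truncate-≥ x a q≤a with toℕ a ℕ.<? q
    ... | yes a<q = ⊥-elim (ℕP.≤⇒≯ q≤a a<q)
    ... | no _ = refl

    ⋆-norm-truncate : ∀ x t → (truncate x ⋆ Nq) t ≡ x (residue t)
    ⋆-norm-truncate x t = begin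
      (truncate x ⋆ Nq) t
        ≡⟨ ⋆-as-sum (truncate x) Nq t ⟩
      sum (λ a → truncate x a * Nq (t ⊖ toℕ a))
        ≡⟨ sum-vanishing-off _ (residue t) off-residue ⟩
      truncate x (residue t) * Nq (t ⊖ toℕ (residue t))
        ≡⟨ cong₂ _*_ (truncate-< x _ (residue<q t)) (norm-≡-1 _ t⊖residue≡0) ⟩
      x (residue t) * 1ℤ
        ≡⟨ ℤP.*-identityʳ (x (residue t)) ⟩
      x (residue t) ∎
      where
      open ≡-Reasoning
      t⊖a≡t-a : ∀ a → + toℕ (t ⊖ toℕ a) ≡ + toℕ t - + toℕ a mod q
      t⊖a≡t-a a = ≡-mod-∣ q∣N (⊖-toℕ-≡-mod t a)
      t⊖residue≡0 : + toℕ (t ⊖ toℕ (residue t)) ≡ 0ℤ mod q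
      t⊖residue≡0 = ≡-mod-trans (t⊖a≡t-a (residue t))
        (≡-mod-trans (≡-mod-- (≡-mod-refl {a = + toℕ t}) (residue-≡-mod t))
                     (≡-mod-reflexive (ℤP.+-inverseʳ (+ toℕ t))))
      off-residue : ∀ a → a ≢ residue t → truncate x a * Nq (t ⊖ toℕ a) ≡ 0ℤ
      off-residue a a≢r with ℕP.<-≤-connex (toℕ a) q
      ... | inj₂ q≤a =
        trans (cong (_* Nq (t ⊖ toℕ a)) (truncate-≥ x a q≤a)) (ℤP.*-zeroˡ (Nq (t ⊖ toℕ a)))
      ... | inj₁ a<q =
        trans (cong (truncate x a *_) (norm-≡-0 (t ⊖ toℕ a) t⊖a≢0)) (ℤP.*-zeroʳ (truncate x a))
        where
        t⊖a≢0 : ¬ (+ toℕ (t ⊖ toℕ a) ≡ 0ℤ mod q)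
        t⊖a≢0 t⊖a≡0 = a≢r (FinP.toℕ-injective (≡-mod⇒≡ a<q (residue<q t) a≡r))
          where
          t≡a : + toℕ t ≡ + toℕ a mod q
          t≡a = Equivalence.from ≡-mod⇔-≡-mod-0 (≡-mod-trans (≡-mod-sym (t⊖a≡t-a a)) t⊖a≡0)
          a≡r : + toℕ a ≡ + toℕ (residue t) mod q
          a≡r = ≡-mod-trans (≡-mod-sym t≡a) (≡-mod-sym (residue-≡-mod t))

    InIdeal₂-norm-ι⇔periodic : ∀ {d} → d ℕD.∣ M → ∀ x →
      InIdeal₂ Nq (ι (+ d)) x ⇔ (∀ t → x (t ⊖ q) ≡ x t mod d)
    InIdeal₂-norm-ι⇔periodic {d} d∣M x = mk⇔ to from
      where
      to : InIdeal₂ Nq (ι (+ d)) x → ∀ t → x (t ⊖ q) ≡ x t mod d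
      to (r , s , x≈rNq+sd) t = begin
        x (t ⊖ q)         ≈⟨ x≡rNq (t ⊖ q) ⟩
        (r ⋆ Nq) (t ⊖ q)  ≡⟨ ⋆-norm-periodic r t ⟩
        (r ⋆ Nq) t        ≈⟨ x≡rNq t ⟨
        x t               ∎
        where
        open ≡-mod-Reasoning d
        x≡rNq : ∀ u → x u ≡ (r ⋆ Nq) u mod d
        x≡rNq u = begin
          x u                            ≈⟨ ≡-mod-∣ d∣M (Equivalence.to (≈⇔≡-mod x _) x≈rNq+sd u) ⟩
          (r ⋆ Nq) u + (s ⋆ ι (+ d)) u   ≡⟨ cong (_+_ ((r ⋆ Nq) u)) (⋆-ι s (+ d) u) ⟩
          (r ⋆ Nq) u + s u * + d         ≈⟨ +-multiple-≡-mod _ (s u) ⟩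
          (r ⋆ Nq) u                     ∎
      from : (∀ t → x (t ⊖ q) ≡ x t mod d) → InIdeal₂ Nq (ι (+ d)) x
      from periodic = truncate x , s , Equivalence.from (≈⇔≡-mod x _) λ t → ≡-mod-reflexive (begin
          x t                                     ≡⟨ split (ℤD._∣_.equality (d∣x-xr t)) ⟩
          x (residue t) + s t * + d               ≡⟨ cong₂ _+_ (⋆-norm-truncate x t) (⋆-ι s (+ d) t) ⟨
          (truncate x ⋆ Nq) t + (s ⋆ ι (+ d)) t   ∎)
        where
        open ≡-Reasoning
        d∣x-xr : ∀ t → + d ℤD.∣ x t - x (residue t)
        d∣x-xr t = ∣-difference (periodic⇒≡-residue x periodic t)
        s : GR N
        s t = ℤD.quotient (d∣x-xr t)
        split : ∀ {a b c} → a - b ≡ c → a ≡ b + c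
        split {a} {b} a-b≡c = trans (sym (rearrange a b)) (cong (_+_ b) a-b≡c)
          where
          rearrange : ∀ a b → b + (a - b) ≡ a
          rearrange = solve-∀

    InAnn-ι⋆[σ^q-1]⇔periodic : ∀ {d c} .{{_ : NonZero c}} → M ≡ d ℕ.* c → ∀ x →
      InAnn (ι (+ c) ⋆ (σ^ q -ᴳ σ^ 0)) x ⇔ (∀ t → x (t ⊖ q) ≡ x t mod d)
    InAnn-ι⋆[σ^q-1]⇔periodic {d} {c} M≡dc x = mk⇔
      (λ ann t → Equivalence.from ≡-mod⇔-≡-mod-0 (Equivalence.to coefficients ann t))
      (λ periodic → Equivalence.from coefficients (λ t → Equivalence.to ≡-mod⇔-≡-mod-0 (periodic t)))
      where
      coefficients : InAnn (ι (+ c) ⋆ (σ^ q -ᴳ σ^ 0)) x ⇔ (∀ t → x (t ⊖ q) - x t ≡ 0ℤ mod d)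
      coefficients = InAnn⇔≡-mod-0 M≡dc (ι (+ c) ⋆ (σ^ q -ᴳ σ^ 0)) x (λ t → x (t ⊖ q) - x t)
                       (⋆-ι⋆[σ^-1] x (+ c) q q≤N)

    annihilator-ι⋆[σ^q-1] : ∀ d c .{{_ : NonZero c}} → M ≡ d ℕ.* c → ∀ x →
      InAnn (ι (+ c) ⋆ (σ^ q -ᴳ σ^ 0)) x ⇔ InIdeal₂ Nq (ι (+ d)) x
    annihilator-ι⋆[σ^q-1] d c M≡dc x = ⇔.trans
      (InAnn-ι⋆[σ^q-1]⇔periodic M≡dc x)
      (⇔.sym (InIdeal₂-norm-ι⇔periodic (ℕD.divides c (trans M≡dc (ℕP.*-comm d c))) x))

lemma2p5 : (p n m : ℕ) → Prime p →
    ((i k : ℕ) → i ≤ n → k ≤ m → (x : GR (p ^ i)) →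
      GroupRing.InAnn (p ^ m) (p ^ i) (GroupRing.ι (p ^ m) (p ^ i) (+ (p ^ k))) x
      ⇔ GroupRing.InIdeal₁ (p ^ m) (p ^ i) (GroupRing.ι (p ^ m) (p ^ i) (+ (p ^ (m ∸ k)))) x)
    × ((i j k : ℕ) → j < i → i ≤ n → k ≤ m → (x : GR (p ^ i)) →
      GroupRing.InAnn (p ^ m) (p ^ i)
        (GroupRing._⋆_ (p ^ m) (p ^ i) (GroupRing.ι (p ^ m) (p ^ i) (+ (p ^ k)))
          (GroupRing._-ᴳ_ (p ^ m) (p ^ i) (GroupRing.σ^ (p ^ m) (p ^ i) (p ^ j)) (GroupRing.σ^ (p ^ m) (p ^ i) 0))) x
      ⇔ GroupRing.InIdeal₂ (p ^ m) (p ^ i) (P p m i j) (GroupRing.ι (p ^ m) (p ^ i) (+ (p ^ (m ∸ k)))) x)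
lemma2p5 p n m p-prime =
  (λ i k _ k≤m → annihilator-ι (p ^ m) (p ^ i) (p ^ (m ∸ k)) (p ^ k) {{ℕP.m^n≢0 p k}} (p^-split k≤m))
  , λ i j k j<i _ k≤m →
      Norm.annihilator-ι⋆[σ^q-1] (p ^ m) (p ^ i) (p ^ j) (p ^ (i ∸ j))
        {{ℕP.m^n≢0 p j}} {{ℕP.m^n≢0 p (i ∸ j)}} (p^-split (ℕP.<⇒≤ j<i))
        (p ^ (m ∸ k)) (p ^ k) {{ℕP.m^n≢0 p k}} (p^-split k≤m)
  where
  open GroupRingProperties using (annihilator-ι; module Norm)
  instance
    p≢0 : NonZero p
    p≢0 = prime⇒nonZero p-prime

  p^-split : ∀ {a b} → b ≤ a → p ^ a ≡ p ^ (a ∸ b) ℕ.* p ^ b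
  p^-split {a} {b} b≤a = trans (cong (p ^_) (sym (ℕP.m∸n+n≡m b≤a))) (ℕP.^-distribˡ-+-* p (a ∸ b) b)
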